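{- Let $G$ be a finite abelian group, let $a_1, \dots, a_k \in G$ and let $R$ be a positive integer. Suppose that $B \subseteq \langle a_1, \dots, a_k \rangle_R$ is a non-empty set. Then there exist positive integers $\ell \leq O(k^2 (\log k + \log R))$ and $S \leq O((2Rk)^{k+ 3})$ and elements $b_1, \dots, b_\ell \in B$ such that $B \subseteq \langle b_1, \dots, b_\ell\rangle_{S}$.
   Context: For elements $c_1,\dots,c_m$ of an abelian group and a nonnegative integer $T$, $\langle c_1,\dots,c_m\rangle_T$ is the set of all $\lambda_1 c_1+\dots+\lambda_m c_m$ with $\lambda_i\in[-T,T]\cap\mathbb{Z}$. Implicit constants in $O(\cdot)$ are absolute. Convention: for $x\ge1$, $\log x$ stands for $\log x+2$. -}

module Defs where

open import Level using (0ℓ)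
open import Algebra.Bundles using (AbelianGroup)
open import Data.Nat using (ℕ; zero; suc; _+_; _≤_)
open import Data.Nat.Logarithm using (⌈log₂_⌉)
open import Data.Integer as ℤ using (ℤ; +_; -[1+_]; ∣_∣)
open import Data.Fin using (Fin; zero; suc)
open import Data.List using (List)
open import Data.List.Relation.Unary.Any using (Any)
open import Data.Product using (Σ; ∃; _×_)

module GroupDefs (G : AbelianGroup 0ℓ 0ℓ) where
  open AbelianGroup G

  natMul : ℕ → Carrier → Carrier
  natMul zero    x = ε
  natMul (suc n) x = x ∙ natMul n x

  intMul : ℤ → Carrier → Carrier
  intMul (+ n)      x = natMul n x
  intMul -[1+ n ]   x = (natMul (suc n) x) ⁻¹

  lincomb : (m : ℕ) → (Fin m → ℤ) → (Fin m → Carrier) → Carrier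
  lincomb zero    λs cs = ε
  lincomb (suc m) λs cs = intMul (λs zero) (cs zero) ∙ lincomb m (λ i → λs (suc i)) (λ i → cs (suc i))

  InSpan : (m : ℕ) → (Fin m → Carrier) → ℕ → Carrier → Set
  InSpan m cs T x = Σ (Fin m → ℤ) λ λs → ((i : Fin m) → ∣ λs i ∣ ≤ T) × (x ≈ lincomb m λs cs)

  _∈ₗ_ : Carrier → List Carrier → Set
  x ∈ₗ B = Any (λ y → x ≈ y) B

  IsFinite : Set
  IsFinite = Σ ℕ λ n → Σ (Fin n → Carrier) λ f → (x : Carrier) → ∃ λ i → f i ≈ x

-- log x := (log₂ rounded up) + 2, a constant-factor equivalent of the paper's log x + 2
lg : ℕ → ℕ
lg x = ⌈log₂ x ⌉ + 2

-- Pass to coefficient vectors in ℤᵏ.  Greedily pick members of B whose vector is not a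
-- {-1,0,1}-combination of the vectors picked so far.  The picked vectors w₁,…,w_ℓ have
-- pairwise distinct subset sums, since a coincidence would write the newest of them as a
-- difference of two subset sums of the others.  These 2^ℓ sums lie in the cube [-Rℓ, Rℓ]ᵏ,
-- so 2^ℓ ≤ (2Rℓ + 1)ᵏ, which forces ℓ = O(k log (kR)).  Every member of B then has its
-- vector in the {-1,0,1}-span of the picked ones, and the homomorphism v ↦ Σ vᵢ aᵢ puts it
-- in ⟨b₁,…,b_ℓ⟩₁.

module Submission where

open import Defs
open import Level using (0ℓ)
open import Algebra.Bundles using (AbelianGroup)
open import Data.Nat using (ℕ; _+_; _*_; _^_; _≤_; _<_)
open import Data.Fin using (Fin)
open import Data.List using (List; _∷_)
open import Data.List.Relation.Unary.All using (All)
open import Data.Product using (Σ; _×_)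

open import Algebra.Core using (Op₁; Op₂)
open import Algebra.Structures using (IsAbelianGroup)
open import Data.Empty using (⊥-elim)
open import Data.Fin using (zero; suc)
open import Data.Fin.Properties using (injective⇒≤)
open import Data.Integer as ℤ using (ℤ; -[1+_]; ∣_∣; 0ℤ)
import Data.Integer.Properties as ℤ
open import Data.List using ([]; _++_; map; length; lookup; drop; cartesianProductWith)
open import Data.List.Properties using (length-++; length-map; length-drop)
open import Data.List.Membership.Propositional using (_∈_; _∉_)
open import Data.List.Membership.Propositional.Properties
  using (∈-++⁺ˡ; ∈-++⁺ʳ; ∈-++⁻; ∈-map⁺; ∈-map⁻; ∈-lookup; ∈-cartesianProductWith⁺)
import Data.List.Membership.Setoid.Properties as Membership
open import Data.List.Relation.Binary.Disjoint.Propositional using (Disjoint)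
open import Data.List.Relation.Binary.Subset.Propositional using (_⊆_)
open import Data.List.Relation.Unary.All as All using ([]; _∷_)
import Data.List.Relation.Unary.All.Properties as All
open import Data.List.Relation.Unary.AllPairs using ([]; _∷_)
open import Data.List.Relation.Unary.Any as Any using (here; there)
open import Data.List.Relation.Unary.Unique.Propositional using (Unique)
import Data.List.Relation.Unary.Unique.Propositional.Properties as Unique
open import Data.Nat using (zero; suc; z≤n; s≤s; ⌊_/2⌋; ⌈_/2⌉)
import Data.Nat as ℕ
import Data.Nat.Properties as ℕ
open import Data.Nat.Induction using (<-wellFounded)
open import Data.Nat.Logarithm using (⌈log₂_⌉)
open import Data.Nat.Logarithm.Core using (⌈log2⌉)
open import Data.Nat.Tactic.RingSolver using (solve-∀)
open import Data.Product using (_,_)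
open import Data.Sum using (inj₁; inj₂)
open import Data.Vec as Vec using (Vec; []; _∷_; zipWith; replicate)
open import Data.Vec.Functional using () renaming (_∷_ to _∷ᶠ_)
import Data.Vec.Properties as Vec
import Data.Vec.Relation.Unary.All as VecAll
import Data.Vec.Relation.Unary.All.Properties as VecAll
open import Function using (_∘_)
open import Induction.WellFounded using (Acc; acc)
open import Relation.Binary.Definitions using (DecidableEquality)
open import Relation.Binary.PropositionalEquality
  using (_≡_; refl; sym; trans; cong; cong₂; subst; subst₂; isEquivalence; module ≡-Reasoning)
import Relation.Binary.PropositionalEquality as ≡
open import Relation.Nullary using (yes; no)

Unique-++⁻ˡ : ∀ {a} {A : Set a} (xs : List A) {ys : List A} → Unique (xs ++ ys) → Unique xs
Unique-++⁻ˡ []       _              = []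
Unique-++⁻ˡ (x ∷ xs) (x∉ ∷ unique) = All.++⁻ˡ xs x∉ ∷ Unique-++⁻ˡ xs unique

Unique⇒lookup-injective : ∀ {a} {A : Set a} {xs : List A} → Unique xs →
                          ∀ {i j} → lookup xs i ≡ lookup xs j → i ≡ j
Unique⇒lookup-injective (_  ∷ _)      {zero}  {zero}  _  = refl
Unique⇒lookup-injective (x∉ ∷ _)      {zero}  {suc j} eq = ⊥-elim (All.lookup x∉ (∈-lookup j) eq)
Unique⇒lookup-injective (x∉ ∷ _)      {suc i} {zero}  eq = ⊥-elim (All.lookup x∉ (∈-lookup i) (sym eq))
Unique⇒lookup-injective (_  ∷ unique) {suc i} {suc j} eq = cong suc (Unique⇒lookup-injective unique eq)

Unique-⊆⇒length≤ : ∀ {a} {A : Set a} {xs ys : List A} → Unique xs → xs ⊆ ys → length xs ≤ length ys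
Unique-⊆⇒length≤ {xs = xs} unique xs⊆ys = injective⇒≤ λ {i} {j} eq →
  Unique⇒lookup-injective unique
    (Membership.index-injective (≡.setoid _) (xs⊆ys (∈-lookup {xs = xs} i)) (xs⊆ys (∈-lookup j)) eq)

length-cartesianProductWith : ∀ {a b c} {A : Set a} {B : Set b} {C : Set c} (f : A → B → C) xs ys →
                              length (cartesianProductWith f xs ys) ≡ length xs * length ys
length-cartesianProductWith f []       ys = refl
length-cartesianProductWith f (x ∷ xs) ys = begin
  length (map (f x) ys ++ cartesianProductWith f xs ys)           ≡⟨ length-++ (map (f x) ys) ⟩
  length (map (f x) ys) + length (cartesianProductWith f xs ys)   ≡⟨ cong₂ _+_ (length-map (f x) ys) (length-cartesianProductWith f xs ys) ⟩
  length ys + length xs * length ys                              ∎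
  where open ≡-Reasoning

module SubsetSums {a} {A : Set a} {_+_ : Op₂ A} {0# : A} { -_ : Op₁ A }
                  (isAbelianGroup : IsAbelianGroup _≡_ _+_ 0# -_) where

  private
    group : AbelianGroup a a
    group = record { isAbelianGroup = isAbelianGroup }
  open AbelianGroup group using (_-_; assoc; identityˡ; identityʳ; inverseˡ; inverseʳ)
  open import Algebra.Properties.AbelianGroup group using (⁻¹-∙-comm; ∙-cancelˡ; //-rightDividesʳ)
  open import Algebra.Properties.CommutativeSemigroup (AbelianGroup.commutativeSemigroup group) using (x∙yz≈y∙xz)

  subsetSums : List A → List A
  subsetSums []      = 0# ∷ []
  subsetSums (w ∷ W) = subsetSums W ++ map (w +_) (subsetSums W)

  signedSums : List A → List A
  signedSums []      = 0# ∷ []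
  signedSums (w ∷ W) = signedSums W ++ map (w +_) (signedSums W) ++ map ((- w) +_) (signedSums W)

  ∈-signedSums-skip : ∀ w W {u} → u ∈ signedSums W → u ∈ signedSums (w ∷ W)
  ∈-signedSums-skip w W = ∈-++⁺ˡ

  ∈-signedSums-add : ∀ w W {u} → u ∈ signedSums W → w + u ∈ signedSums (w ∷ W)
  ∈-signedSums-add w W p = ∈-++⁺ʳ (signedSums W) (∈-++⁺ˡ (∈-map⁺ (w +_) p))

  ∈-signedSums-sub : ∀ w W {u} → u ∈ signedSums W → (- w) + u ∈ signedSums (w ∷ W)
  ∈-signedSums-sub w W p = ∈-++⁺ʳ (signedSums W) (∈-++⁺ʳ (map (w +_) (signedSums W)) (∈-map⁺ ((- w) +_) p))

  0#∈signedSums : ∀ W → 0# ∈ signedSums W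
  0#∈signedSums []      = here refl
  0#∈signedSums (w ∷ W) = ∈-signedSums-skip w W (0#∈signedSums W)

  ∈-signedSums-head : ∀ w W → w ∈ signedSums (w ∷ W)
  ∈-signedSums-head w W = subst (_∈ signedSums (w ∷ W)) (identityʳ w) (∈-signedSums-add w W (0#∈signedSums W))

  x-[w+y]≡-w+[x-y] : ∀ w x y → x - (w + y) ≡ (- w) + (x - y)
  x-[w+y]≡-w+[x-y] w x y = begin
    x + (- (w + y))     ≡⟨ cong (x +_) (sym (⁻¹-∙-comm w y)) ⟩
    x + ((- w) + (- y)) ≡⟨ x∙yz≈y∙xz x (- w) (- y) ⟩
    (- w) + (x - y)     ∎
    where open ≡-Reasoning

  [w+x]-[w+y]≡x-y : ∀ w x y → (w + x) - (w + y) ≡ x - y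
  [w+x]-[w+y]≡x-y w x y = begin
    (w + x) - (w + y)       ≡⟨ x-[w+y]≡-w+[x-y] w (w + x) y ⟩
    (- w) + ((w + x) - y)   ≡⟨ cong ((- w) +_) (assoc w x (- y)) ⟩
    (- w) + (w + (x - y))   ≡⟨ sym (assoc (- w) w (x - y)) ⟩
    ((- w) + w) + (x - y)   ≡⟨ cong (_+ (x - y)) (inverseˡ w) ⟩
    0# + (x - y)            ≡⟨ identityˡ (x - y) ⟩
    x - y                   ∎
    where open ≡-Reasoning

  subsetSums-difference : ∀ W {x y} → x ∈ subsetSums W → y ∈ subsetSums W → x - y ∈ signedSums W
  subsetSums-difference []      (here refl) (here refl) = here (inverseʳ 0#)
  subsetSums-difference (w ∷ W) x∈ y∈ with ∈-++⁻ (subsetSums W) x∈ | ∈-++⁻ (subsetSums W) y∈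
  ... | inj₁ x∈′ | inj₁ y∈′ = ∈-signedSums-skip w W (subsetSums-difference W x∈′ y∈′)
  ... | inj₂ x∈′ | inj₁ y∈′ with _ , x∈″ , refl ← ∈-map⁻ (w +_) x∈′ =
    subst (_∈ signedSums (w ∷ W)) (sym (assoc w _ _)) (∈-signedSums-add w W (subsetSums-difference W x∈″ y∈′))
  ... | inj₁ x∈′ | inj₂ y∈′ with _ , y∈″ , refl ← ∈-map⁻ (w +_) y∈′ =
    subst (_∈ signedSums (w ∷ W)) (sym (x-[w+y]≡-w+[x-y] w _ _)) (∈-signedSums-sub w W (subsetSums-difference W x∈′ y∈″))
  ... | inj₂ x∈′ | inj₂ y∈′ with _ , x∈″ , refl ← ∈-map⁻ (w +_) x∈′ | _ , y∈″ , refl ← ∈-map⁻ (w +_) y∈′ =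
    subst (_∈ signedSums (w ∷ W)) (sym ([w+x]-[w+y]≡x-y w _ _)) (∈-signedSums-skip w W (subsetSums-difference W x∈″ y∈″))

  Independent : List A → Set a
  Independent W = Unique (subsetSums W)

  independent-∷ : ∀ w W → Independent W → w ∉ signedSums W → Independent (w ∷ W)
  independent-∷ w W independent w∉ =
    Unique.++⁺ independent (Unique.map⁺ (∙-cancelˡ w _ _) independent) disjoint
    where
    disjoint : Disjoint (subsetSums W) (map (w +_) (subsetSums W))
    disjoint (x∈ , w+y∈) with y , y∈ , refl ← ∈-map⁻ (w +_) w+y∈ =
      w∉ (subst (_∈ signedSums W) (//-rightDividesʳ y w) (subsetSums-difference W x∈ y∈))

  independent-drop : ∀ j W → Independent W → Independent (drop j W)
  independent-drop zero    W       independent = independent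
  independent-drop (suc j) []      independent = independent
  independent-drop (suc j) (w ∷ W) independent = independent-drop j W (Unique-++⁻ˡ (subsetSums W) independent)

  length-subsetSums : ∀ W → length (subsetSums W) ≡ 2 ^ length W
  length-subsetSums []      = refl
  length-subsetSums (w ∷ W) = begin
    length (subsetSums W ++ map (w +_) (subsetSums W))           ≡⟨ length-++ (subsetSums W) ⟩
    length (subsetSums W) ℕ.+ length (map (w +_) (subsetSums W)) ≡⟨ cong (length (subsetSums W) ℕ.+_) (length-map (w +_) (subsetSums W)) ⟩
    length (subsetSums W) ℕ.+ length (subsetSums W)               ≡⟨ cong (λ n → n ℕ.+ n) (length-subsetSums W) ⟩
    2 ^ length W ℕ.+ 2 ^ length W                                 ≡⟨ cong (2 ^ length W ℕ.+_) (sym (ℕ.+-identityʳ _)) ⟩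
    2 ^ suc (length W)                                            ∎
    where open ≡-Reasoning

  module Basis (_≟_ : DecidableEquality A) {ℓ} {X : Set ℓ} (f : X → A) where
    open import Data.List.Membership.DecPropositional _≟_ using (_∈?_)

    basis : List X → List X
    basis []       = []
    basis (x ∷ xs) with f x ∈? signedSums (map f (basis xs))
    ... | yes _ = basis xs
    ... | no  _ = x ∷ basis xs

    basis-⊆ : ∀ xs → basis xs ⊆ xs
    basis-⊆ (x ∷ xs) p with f x ∈? signedSums (map f (basis xs))
    basis-⊆ (x ∷ xs) p         | yes _ = there (basis-⊆ xs p)
    basis-⊆ (x ∷ xs) (here eq) | no  _ = here eq
    basis-⊆ (x ∷ xs) (there p) | no  _ = there (basis-⊆ xs p)

    basis-independent : ∀ xs → Independent (map f (basis xs))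
    basis-independent []       = [] ∷ []
    basis-independent (x ∷ xs) with f x ∈? signedSums (map f (basis xs))
    ... | yes _   = basis-independent xs
    ... | no  fx∉ = independent-∷ (f x) (map f (basis xs)) (basis-independent xs) fx∉

    basis-spans : ∀ xs → All (λ x → f x ∈ signedSums (map f (basis xs))) xs
    basis-spans []       = []
    basis-spans (x ∷ xs) with f x ∈? signedSums (map f (basis xs))
    ... | yes fx∈ = fx∈ ∷ basis-spans xs
    ... | no  _   = ∈-signedSums-head (f x) (map f (basis xs)) ∷ All.map (∈-signedSums-skip (f x) (map f (basis xs))) (basis-spans xs)

infixl 6 _+ᵛ_
_+ᵛ_ : ∀ {n} → Vec ℤ n → Vec ℤ n → Vec ℤ n
_+ᵛ_ = zipWith ℤ._+_

-ᵛ_ : ∀ {n} → Vec ℤ n → Vec ℤ n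
-ᵛ_ = Vec.map (ℤ.-_)

0ᵛ : ∀ {n} → Vec ℤ n
0ᵛ = replicate _ 0ℤ

+ᵛ-isAbelianGroup : ∀ n → IsAbelianGroup _≡_ (_+ᵛ_ {n}) 0ᵛ -ᵛ_
+ᵛ-isAbelianGroup n = record
  { isGroup = record
    { isMonoid = record
      { isSemigroup = record
        { isMagma = record { isEquivalence = isEquivalence ; ∙-cong = cong₂ _+ᵛ_ }
        ; assoc   = Vec.zipWith-assoc ℤ.+-assoc
        }
      ; identity = Vec.zipWith-identityˡ ℤ.+-identityˡ , Vec.zipWith-identityʳ ℤ.+-identityʳ
      }
    ; inverse = Vec.zipWith-inverseˡ ℤ.+-inverseˡ , Vec.zipWith-inverseʳ ℤ.+-inverseʳ
    ; ⁻¹-cong = cong -ᵛ_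
    }
  ; comm = Vec.zipWith-comm ℤ.+-comm
  }

Bounded : ∀ {n} → ℕ → Vec ℤ n → Set
Bounded T = VecAll.All (λ z → ∣ z ∣ ≤ T)

0ᵛ-bounded : ∀ {n} T → Bounded T (0ᵛ {n})
0ᵛ-bounded {zero}  T = VecAll.[]
0ᵛ-bounded {suc n} T = z≤n VecAll.∷ 0ᵛ-bounded T

+ᵛ-bounded : ∀ {n S T} {v w : Vec ℤ n} → Bounded S v → Bounded T w → Bounded (S + T) (v +ᵛ w)
+ᵛ-bounded = VecAll.zipWith λ {x} {y} ∣x∣≤S ∣y∣≤T → ℕ.≤-trans (ℤ.∣i+j∣≤∣i∣+∣j∣ x y) (ℕ.+-mono-≤ ∣x∣≤S ∣y∣≤T)

bounded-mono : ∀ {n S T} {v : Vec ℤ n} → S ≤ T → Bounded S v → Bounded T v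
bounded-mono S≤T = VecAll.map (λ ∣z∣≤S → ℕ.≤-trans ∣z∣≤S S≤T)

interval : ℕ → List ℤ
interval zero    = 0ℤ ∷ []
interval (suc T) = ℤ.+ suc T ∷ -[1+ T ] ∷ interval T

length-interval : ∀ T → length (interval T) ≡ suc (2 * T)
length-interval zero    = refl
length-interval (suc T) = trans (cong (ℕ.suc ∘ ℕ.suc) (length-interval T)) (cong suc (sym (ℕ.*-suc 2 T)))

∈-interval : ∀ T {z} → ∣ z ∣ ≤ T → z ∈ interval T
∈-interval zero    {ℤ.+ zero}   _          = here refl
∈-interval (suc T) {ℤ.+ n}      ∣z∣≤1+T     with ℕ.m≤n⇒m<n∨m≡n ∣z∣≤1+T
... | inj₂ refl        = here refl
... | inj₁ (s≤s ∣z∣≤T) = there (there (∈-interval T ∣z∣≤T))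
∈-interval (suc T) { -[1+ n ]} (s≤s n≤T) with ℕ.m≤n⇒m<n∨m≡n n≤T
... | inj₂ refl = there (here refl)
... | inj₁ n<T  = there (there (∈-interval T n<T))

cube : ℕ → (n : ℕ) → List (Vec ℤ n)
cube T zero    = [] ∷ []
cube T (suc n) = cartesianProductWith _∷_ (interval T) (cube T n)

length-cube : ∀ T n → length (cube T n) ≡ suc (2 * T) ^ n
length-cube T zero    = refl
length-cube T (suc n) = trans (length-cartesianProductWith _∷_ (interval T) (cube T n))
                              (cong₂ _*_ (length-interval T) (length-cube T n))

∈-cube : ∀ T {n} {v : Vec ℤ n} → Bounded T v → v ∈ cube T n
∈-cube T VecAll.[]            = here refl
∈-cube T (∣z∣≤T VecAll.∷ bnd) = ∈-cartesianProductWith⁺ _∷_ (∈-interval T ∣z∣≤T) (∈-cube T bnd)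

n≤2^⌈log2⌉n : ∀ n (acc : Acc _<_ n) → n ≤ 2 ^ ⌈log2⌉ n acc
n≤2^⌈log2⌉n zero          _        = z≤n
n≤2^⌈log2⌉n (suc zero)    _        = s≤s z≤n
n≤2^⌈log2⌉n (suc (suc n)) (acc rs) = begin
  2 + n                 ≤⟨ ℕ.+-monoʳ-≤ 2 n≤2⌈n/2⌉ ⟩
  2 + 2 * ⌈ n /2⌉       ≡⟨ ℕ.*-suc 2 ⌈ n /2⌉ ⟨
  2 * suc ⌈ n /2⌉       ≤⟨ ℕ.*-monoʳ-≤ 2 (n≤2^⌈log2⌉n (suc ⌈ n /2⌉) (rs (ℕ.⌈n/2⌉<n n))) ⟩
  2 ^ ⌈log2⌉ (2 + n) (acc rs) ∎
  where
  open ℕ.≤-Reasoning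
  n≤2⌈n/2⌉ : n ≤ 2 * ⌈ n /2⌉
  n≤2⌈n/2⌉ = begin
    n                     ≡⟨ ℕ.⌊n/2⌋+⌈n/2⌉≡n n ⟨
    ⌊ n /2⌋ + ⌈ n /2⌉     ≤⟨ ℕ.+-monoˡ-≤ ⌈ n /2⌉ (ℕ.⌊n/2⌋≤⌈n/2⌉ n) ⟩
    ⌈ n /2⌉ + ⌈ n /2⌉     ≡⟨ cong (⌈ n /2⌉ +_) (ℕ.+-identityʳ _) ⟨
    2 * ⌈ n /2⌉           ∎

n≤2^⌈log₂n⌉ : ∀ n → n ≤ 2 ^ ⌈log₂ n ⌉
n≤2^⌈log₂n⌉ n = n≤2^⌈log2⌉n n (<-wellFounded n)

n<2^n : ∀ n → n < 2 ^ n
n<2^n zero    = s≤s z≤n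
n<2^n (suc n) = begin-strict
  suc n         <⟨ s≤s (n<2^n n) ⟩
  1 + 2 ^ n     ≤⟨ ℕ.+-monoˡ-≤ (2 ^ n) (ℕ.m^n>0 2 n) ⟩
  2 ^ n + 2 ^ n ≡⟨ cong (2 ^ n +_) (ℕ.+-identityʳ _) ⟨
  2 ^ suc n     ∎
  where open ℕ.≤-Reasoning

basisBound : ℕ → ℕ → ℕ
basisBound k R = k * (2 * (3 + (⌈log₂ k ⌉ + ⌈log₂ R ⌉)))

cubeSize<2^basisBound : ∀ k R → 1 ≤ k → 1 ≤ R → suc (2 * (R * basisBound k R)) ^ k < 2 ^ basisBound k R
cubeSize<2^basisBound k R 1≤k 1≤R = begin-strict
  suc (2 * (R * (k * M))) ^ k <⟨ ℕ.^-monoˡ-< k {{ℕ.>-nonZero 1≤k}} side<2^M ⟩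
  (2 ^ M) ^ k                 ≡⟨ ℕ.^-*-assoc 2 M k ⟩
  2 ^ (M * k)                 ≡⟨ cong (2 ^_) (ℕ.*-comm M k) ⟩
  2 ^ (k * M)                 ∎
  where
  open ℕ.≤-Reasoning
  q = ⌈log₂ k ⌉ + ⌈log₂ R ⌉
  M = 2 * (3 + q)

  kR≤2^q : k * R ≤ 2 ^ q
  kR≤2^q = begin
    k * R                         ≤⟨ ℕ.*-mono-≤ (n≤2^⌈log₂n⌉ k) (n≤2^⌈log₂n⌉ R) ⟩
    2 ^ ⌈log₂ k ⌉ * 2 ^ ⌈log₂ R ⌉ ≡⟨ ℕ.^-distribˡ-+-* 2 ⌈log₂ k ⌉ ⌈log₂ R ⌉ ⟨
    2 ^ q                         ∎

  1≤RkM : 1 ≤ R * (k * M)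
  1≤RkM = ℕ.*-mono-≤ 1≤R (ℕ.*-mono-≤ 1≤k (s≤s z≤n))

  regroup : ∀ R k M → 2 * (R * (k * M)) + 2 * (R * (k * M)) ≡ M * (2 * (2 * (k * R)))
  regroup = solve-∀

  exponent : ∀ q → (4 + q) + (2 + q) ≡ 2 * (3 + q)
  exponent = solve-∀

  side<2^M : suc (2 * (R * (k * M))) < 2 ^ M
  side<2^M = begin-strict
    1 + 2 * (R * (k * M))                   ≤⟨ ℕ.+-monoˡ-≤ _ (ℕ.≤-trans 1≤RkM (ℕ.m≤m+n _ _)) ⟩
    2 * (R * (k * M)) + 2 * (R * (k * M))   ≡⟨ regroup R k M ⟩
    M * (2 * (2 * (k * R)))                 ≤⟨ ℕ.*-monoʳ-≤ M (ℕ.*-monoʳ-≤ 2 (ℕ.*-monoʳ-≤ 2 kR≤2^q)) ⟩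
    M * 2 ^ (2 + q)                         <⟨ ℕ.*-monoˡ-< (2 ^ (2 + q)) {{ℕ.>-nonZero (ℕ.m^n>0 2 (2 + q))}} (ℕ.*-monoʳ-< 2 (n<2^n (3 + q))) ⟩
    2 ^ (4 + q) * 2 ^ (2 + q)               ≡⟨ ℕ.^-distribˡ-+-* 2 (4 + q) (2 + q) ⟨
    2 ^ ((4 + q) + (2 + q))                 ≡⟨ cong (2 ^_) (exponent q) ⟩
    2 ^ M                                   ∎

basisBound≤ : ∀ k R → 1 ≤ k → basisBound k R ≤ 2 * (k * k * (lg k + lg R))
basisBound≤ k R 1≤k = begin
  k * (2 * (3 + (a + r)))               ≤⟨ ℕ.*-mono-≤ (ℕ.m≤m*n k k {{ℕ.>-nonZero 1≤k}}) (ℕ.*-monoʳ-≤ 2 3+a+r≤) ⟩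
  k * k * (2 * ((a + 2) + (r + 2)))     ≡⟨ swap (k * k) ((a + 2) + (r + 2)) ⟩
  2 * (k * k * ((a + 2) + (r + 2)))     ∎
  where
  open ℕ.≤-Reasoning
  a = ⌈log₂ k ⌉
  r = ⌈log₂ R ⌉
  shift : ∀ a r → 1 + (3 + (a + r)) ≡ (a + 2) + (r + 2)
  shift = solve-∀
  3+a+r≤ : 3 + (a + r) ≤ (a + 2) + (r + 2)
  3+a+r≤ = ℕ.≤-trans (ℕ.n≤1+n _) (ℕ.≤-reflexive (shift a r))
  swap : ∀ m n → m * (2 * n) ≡ 2 * (m * n)
  swap = solve-∀

module _ {n : ℕ} where
  open SubsetSums (+ᵛ-isAbelianGroup n)

  subsetSums-bounded : ∀ R (W : List (Vec ℤ n)) → All (Bounded R) W → All (Bounded (R * length W)) (subsetSums W)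
  subsetSums-bounded R []      []          = 0ᵛ-bounded _ ∷ []
  subsetSums-bounded R (w ∷ W) (w≤R ∷ W≤R) =
    All.++⁺ (All.map (bounded-mono (ℕ.*-monoʳ-≤ R (ℕ.n≤1+n _))) sums≤)
            (All.map⁺ (All.map (λ {u} → w+u-bounded {u}) sums≤))
    where
    sums≤ = subsetSums-bounded R W W≤R
    w+u-bounded : ∀ {u} → Bounded (R * length W) u → Bounded (R * suc (length W)) (w +ᵛ u)
    w+u-bounded {u} u≤ = subst (λ T → Bounded T (w +ᵛ u)) (sym (ℕ.*-suc R (length W))) (+ᵛ-bounded w≤R u≤)

  independent-count : ∀ R (W : List (Vec ℤ n)) → All (Bounded R) W → Independent W →
                      2 ^ length W ≤ suc (2 * (R * length W)) ^ n
  independent-count R W W≤R independent =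
    subst₂ _≤_ (length-subsetSums W) (length-cube (R * length W) n)
      (Unique-⊆⇒length≤ independent (∈-cube _ ∘ All.lookup (subsetSums-bounded R W W≤R)))

  independent-length< : ∀ R (W : List (Vec ℤ n)) → 1 ≤ n → 1 ≤ R → All (Bounded R) W → Independent W →
                        length W < basisBound n R
  -- A longer independent list has an independent suffix of length exactly basisBound n R,
  -- whose subset sums cannot all fit in their cube.
  independent-length< R W 1≤n 1≤R W≤R independent with length W ℕ.<? basisBound n R
  ... | yes <N = <N
  ... | no  ≮N = ⊥-elim (ℕ.<⇒≱ (cubeSize<2^basisBound n R 1≤n 1≤R)
                  (subst (λ m → 2 ^ m ≤ suc (2 * (R * m)) ^ n) length-suffix
                     (independent-count R suffix (All.drop⁺ j W≤R) (independent-drop j W independent))))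
    where
    j = length W ℕ.∸ basisBound n R
    suffix = drop j W
    length-suffix : length suffix ≡ basisBound n R
    length-suffix = trans (length-drop j W) (ℕ.m∸[m∸n]≡n (ℕ.≮⇒≥ ≮N))

module LinearCombinations (G : AbelianGroup 0ℓ 0ℓ) where
  open AbelianGroup G renaming (refl to ≈-refl; sym to ≈-sym; trans to ≈-trans)
  open GroupDefs G
  open import Relation.Binary.Reasoning.Setoid setoid
  open import Algebra.Properties.AbelianGroup G using (⁻¹-∙-comm; ε⁻¹≈ε; ⁻¹-involutive)
  open import Algebra.Properties.CommutativeSemigroup commutativeSemigroup using (interchange)
  open import Algebra.Properties.Monoid.Mult monoid using (×-homo-+) renaming (_×_ to _×ᴹ_)

  natMul≡×ᴹ : ∀ n x → natMul n x ≡ n ×ᴹ x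
  natMul≡×ᴹ zero    x = refl
  natMul≡×ᴹ (suc n) x = cong (x ∙_) (natMul≡×ᴹ n x)

  natMul-+ : ∀ m n x → natMul (m + n) x ≈ natMul m x ∙ natMul n x
  natMul-+ m n x rewrite natMul≡×ᴹ (m + n) x | natMul≡×ᴹ m x | natMul≡×ᴹ n x = ×-homo-+ x m n

  intMul-⊖ : ∀ m n x → intMul (m ℤ.⊖ n) x ≈ natMul m x ∙ natMul n x ⁻¹
  intMul-⊖ m zero x = begin
    intMul (m ℤ.⊖ 0) x   ≡⟨ cong (λ z → intMul z x) (ℤ.⊖-≥ {m} {0} z≤n) ⟩
    natMul m x           ≈⟨ identityʳ _ ⟨
    natMul m x ∙ ε       ≈⟨ ∙-congˡ ε⁻¹≈ε ⟨
    natMul m x ∙ ε ⁻¹    ∎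
  intMul-⊖ zero (suc n) x = begin
    intMul (0 ℤ.⊖ suc n) x     ≡⟨ cong (λ z → intMul z x) (ℤ.⊖-≤ {0} {suc n} z≤n) ⟩
    natMul (suc n) x ⁻¹        ≈⟨ identityˡ _ ⟨
    ε ∙ natMul (suc n) x ⁻¹    ∎
  intMul-⊖ (suc m) (suc n) x = begin
    intMul (suc m ℤ.⊖ suc n) x              ≡⟨ cong (λ z → intMul z x) (ℤ.[1+m]⊖[1+n]≡m⊖n m n) ⟩
    intMul (m ℤ.⊖ n) x                      ≈⟨ intMul-⊖ m n x ⟩
    natMul m x ∙ natMul n x ⁻¹              ≈⟨ cancel ⟨
    (x ∙ natMul m x) ∙ (x ∙ natMul n x) ⁻¹  ∎
    where
    cancel : (x ∙ natMul m x) ∙ (x ∙ natMul n x) ⁻¹ ≈ natMul m x ∙ natMul n x ⁻¹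
    cancel = begin
      (x ∙ natMul m x) ∙ (x ∙ natMul n x) ⁻¹       ≈⟨ ∙-congˡ (⁻¹-∙-comm x (natMul n x)) ⟨
      (x ∙ natMul m x) ∙ (x ⁻¹ ∙ natMul n x ⁻¹)    ≈⟨ interchange x (natMul m x) (x ⁻¹) (natMul n x ⁻¹) ⟩
      (x ∙ x ⁻¹) ∙ (natMul m x ∙ natMul n x ⁻¹)    ≈⟨ ∙-congʳ (inverseʳ x) ⟩
      ε ∙ (natMul m x ∙ natMul n x ⁻¹)             ≈⟨ identityˡ _ ⟩
      natMul m x ∙ natMul n x ⁻¹                   ∎

  intMul-+ : ∀ y z x → intMul (y ℤ.+ z) x ≈ intMul y x ∙ intMul z x
  intMul-+ (ℤ.+ m)  (ℤ.+ n)  x = natMul-+ m n x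
  intMul-+ (ℤ.+ m)  -[1+ n ] x = intMul-⊖ m (suc n) x
  intMul-+ -[1+ m ] (ℤ.+ n)  x = ≈-trans (intMul-⊖ n (suc m) x) (comm _ _)
  intMul-+ -[1+ m ] -[1+ n ] x = begin
    natMul (suc (suc (m + n))) x ⁻¹              ≡⟨ cong (λ l → natMul l x ⁻¹) (ℕ.+-suc (suc m) n) ⟨
    natMul (suc m + suc n) x ⁻¹                  ≈⟨ ⁻¹-cong (natMul-+ (suc m) (suc n) x) ⟩
    (natMul (suc m) x ∙ natMul (suc n) x) ⁻¹     ≈⟨ ⁻¹-∙-comm _ _ ⟨
    natMul (suc m) x ⁻¹ ∙ natMul (suc n) x ⁻¹    ∎

  intMul-neg : ∀ z x → intMul (ℤ.- z) x ≈ intMul z x ⁻¹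
  intMul-neg (ℤ.+ zero)    x = ≈-sym ε⁻¹≈ε
  intMul-neg (ℤ.+ (suc n)) x = ≈-refl
  intMul-neg -[1+ n ]      x = ≈-sym (⁻¹-involutive _)

  lincomb-cong : ∀ m {λs μs : Fin m → ℤ} cs → (∀ i → λs i ≡ μs i) → lincomb m λs cs ≈ lincomb m μs cs
  lincomb-cong zero    cs λs≡μs = ≈-refl
  lincomb-cong (suc m) cs λs≡μs =
    ∙-cong (reflexive (cong (λ z → intMul z (cs zero)) (λs≡μs zero))) (lincomb-cong m (cs ∘ suc) (λs≡μs ∘ suc))

  lincomb-0ᵛ : ∀ m cs → lincomb m (Vec.lookup (0ᵛ {m})) cs ≈ ε
  lincomb-0ᵛ zero    cs = ≈-refl
  lincomb-0ᵛ (suc m) cs = ≈-trans (identityˡ _) (lincomb-0ᵛ m (cs ∘ suc))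

  lincomb-+ᵛ : ∀ {m} (v w : Vec ℤ m) cs →
               lincomb m (Vec.lookup (v +ᵛ w)) cs ≈ lincomb m (Vec.lookup v) cs ∙ lincomb m (Vec.lookup w) cs
  lincomb-+ᵛ []       []       cs = ≈-sym (identityˡ ε)
  lincomb-+ᵛ (y ∷ v) (z ∷ w) cs = begin
    intMul (y ℤ.+ z) (cs zero) ∙ lincomb _ (Vec.lookup (v +ᵛ w)) (cs ∘ suc)
      ≈⟨ ∙-cong (intMul-+ y z (cs zero)) (lincomb-+ᵛ v w (cs ∘ suc)) ⟩
    (intMul y (cs zero) ∙ intMul z (cs zero)) ∙ (lincomb _ (Vec.lookup v) (cs ∘ suc) ∙ lincomb _ (Vec.lookup w) (cs ∘ suc))
      ≈⟨ interchange _ _ _ _ ⟩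
    (intMul y (cs zero) ∙ lincomb _ (Vec.lookup v) (cs ∘ suc)) ∙ (intMul z (cs zero) ∙ lincomb _ (Vec.lookup w) (cs ∘ suc))
      ∎

  lincomb--ᵛ : ∀ {m} (v : Vec ℤ m) cs → lincomb m (Vec.lookup (-ᵛ v)) cs ≈ lincomb m (Vec.lookup v) cs ⁻¹
  lincomb--ᵛ []      cs = ≈-sym ε⁻¹≈ε
  lincomb--ᵛ (z ∷ v) cs = begin
    intMul (ℤ.- z) (cs zero) ∙ lincomb _ (Vec.lookup (-ᵛ v)) (cs ∘ suc)   ≈⟨ ∙-cong (intMul-neg z (cs zero)) (lincomb--ᵛ v (cs ∘ suc)) ⟩
    intMul z (cs zero) ⁻¹ ∙ lincomb _ (Vec.lookup v) (cs ∘ suc) ⁻¹        ≈⟨ ⁻¹-∙-comm _ _ ⟩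
    (intMul z (cs zero) ∙ lincomb _ (Vec.lookup v) (cs ∘ suc)) ⁻¹         ∎

  InSpan-∷ : ∀ {m T x y} cs z → ∣ z ∣ ≤ T → y ≈ intMul z (cs zero) ∙ x → InSpan m (cs ∘ suc) T x → InSpan (suc m) cs T y
  InSpan-∷ cs z ∣z∣≤T y≈ (λs , λs≤T , x≈) = z ∷ᶠ λs , (λ { zero → ∣z∣≤T ; (suc i) → λs≤T i }) , ≈-trans y≈ (∙-congˡ x≈)

module SpanningMembers (G : AbelianGroup 0ℓ 0ℓ) {k : ℕ} (a : Fin k → AbelianGroup.Carrier G) (R : ℕ) where
  open AbelianGroup G renaming (refl to ≈-refl; sym to ≈-sym; trans to ≈-trans)
  open GroupDefs G
  open LinearCombinations G
  open SubsetSums (+ᵛ-isAbelianGroup k)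
  open import Relation.Binary.Reasoning.Setoid setoid

  ⟦_⟧ : Vec ℤ k → Carrier
  ⟦ v ⟧ = lincomb k (Vec.lookup v) a

  record Coordinates : Set where
    field
      element   : Carrier
      vector    : Vec ℤ k
      bounded   : Bounded R vector
      evaluates : element ≈ ⟦ vector ⟧
  open Coordinates

  coordinates : ∀ {b} → InSpan k a R b → Coordinates
  coordinates {b} (λs , λs≤R , b≈) = record
    { element   = b
    ; vector    = Vec.tabulate λs
    ; bounded   = VecAll.tabulate⁺ λs≤R
    ; evaluates = ≈-trans b≈ (lincomb-cong k a (λ i → sym (Vec.lookup∘tabulate λs i)))
    }

  coordinatesOf : ∀ {bs} → All (InSpan k a R) bs → List Coordinates
  coordinatesOf []       = []
  coordinatesOf (s ∷ ss) = coordinates s ∷ coordinatesOf ss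

  map-element-coordinatesOf : ∀ {bs} (ss : All (InSpan k a R) bs) → map element (coordinatesOf ss) ≡ bs
  map-element-coordinatesOf []       = refl
  map-element-coordinatesOf (s ∷ ss) = cong (_ ∷_) (map-element-coordinatesOf ss)

  signedSums-InSpan : ∀ W {u} → u ∈ signedSums (map vector W) → InSpan (length W) (element ∘ lookup W) 1 ⟦ u ⟧
  signedSums-InSpan []      (here refl) = (λ ()) , (λ ()) , lincomb-0ᵛ k a
  signedSums-InSpan (w ∷ W) u∈ with ∈-++⁻ (signedSums (map vector W)) u∈
  ... | inj₁ u∈′ = InSpan-∷ (element ∘ lookup (w ∷ W)) 0ℤ z≤n (≈-sym (identityˡ _)) (signedSums-InSpan W u∈′)
  ... | inj₂ u∈′ with ∈-++⁻ (map (vector w +ᵛ_) (signedSums (map vector W))) u∈′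
  ...   | inj₁ u∈″ with s , s∈ , refl ← ∈-map⁻ (vector w +ᵛ_) u∈″ =
    InSpan-∷ (element ∘ lookup (w ∷ W)) (ℤ.+ 1) (s≤s z≤n) (begin
      ⟦ vector w +ᵛ s ⟧        ≈⟨ lincomb-+ᵛ (vector w) s a ⟩
      ⟦ vector w ⟧ ∙ ⟦ s ⟧     ≈⟨ ∙-congʳ (evaluates w) ⟨
      element w ∙ ⟦ s ⟧        ≈⟨ ∙-congʳ (identityʳ _) ⟨
      (element w ∙ ε) ∙ ⟦ s ⟧  ∎) (signedSums-InSpan W s∈)
  ...   | inj₂ u∈″ with s , s∈ , refl ← ∈-map⁻ ((-ᵛ vector w) +ᵛ_) u∈″ =
    InSpan-∷ (element ∘ lookup (w ∷ W)) -[1+ 0 ] (s≤s z≤n) (begin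
      ⟦ (-ᵛ vector w) +ᵛ s ⟧        ≈⟨ lincomb-+ᵛ (-ᵛ vector w) s a ⟩
      ⟦ -ᵛ vector w ⟧ ∙ ⟦ s ⟧       ≈⟨ ∙-congʳ (lincomb--ᵛ (vector w) a) ⟩
      ⟦ vector w ⟧ ⁻¹ ∙ ⟦ s ⟧       ≈⟨ ∙-congʳ (⁻¹-cong (≈-trans (identityʳ _) (evaluates w))) ⟨
      (element w ∙ ε) ⁻¹ ∙ ⟦ s ⟧    ∎) (signedSums-InSpan W s∈)

  few-members-span : ∀ {b₀ bs} → 1 ≤ k → 1 ≤ R → All (InSpan k a R) (b₀ ∷ bs) →
    Σ ℕ λ ℓ → Σ (Fin ℓ → Carrier) λ b →
      1 ≤ ℓ × ℓ ≤ basisBound k R × ((i : Fin ℓ) → b i ∈ₗ (b₀ ∷ bs)) × All (InSpan ℓ b 1) (b₀ ∷ bs)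
  few-members-span {b₀} {bs} 1≤k 1≤R spans@(s₀ ∷ _) =
    length Gs , element ∘ lookup Gs , s≤s z≤n , length-Gs≤ , members , spanned
    where
    open Basis (Vec.≡-dec ℤ._≟_) vector
    cs = coordinatesOf spans
    -- b₀ is kept so that ℓ ≥ 1 even when every coefficient vector is 0.
    Gs = coordinates s₀ ∷ basis cs

    length-Gs≤ : length Gs ≤ basisBound k R
    length-Gs≤ = subst (_< basisBound k R) (length-map vector (basis cs))
      (independent-length< R (map vector (basis cs)) 1≤k 1≤R
         (All.map⁺ (All.universal bounded (basis cs))) (basis-independent cs))

    Gs⊆cs : Gs ⊆ cs
    Gs⊆cs (here refl) = here refl
    Gs⊆cs (there c∈)  = basis-⊆ cs c∈

    members : ∀ i → element (lookup Gs i) ∈ₗ (b₀ ∷ bs)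
    members i = Any.map reflexive
      (subst (element (lookup Gs i) ∈_) (map-element-coordinatesOf spans) (∈-map⁺ element (Gs⊆cs (∈-lookup i))))

    element-InSpan : ∀ {c} → vector c ∈ signedSums (map vector (basis cs)) →
                     InSpan (length Gs) (element ∘ lookup Gs) 1 (element c)
    element-InSpan {c} vc∈
      with λs , λs≤1 , ⟦vc⟧≈ ← signedSums-InSpan Gs (∈-signedSums-skip _ (map vector (basis cs)) vc∈) =
      λs , λs≤1 , ≈-trans (evaluates c) ⟦vc⟧≈

    spanned : All (InSpan (length Gs) (element ∘ lookup Gs) 1) (b₀ ∷ bs)
    spanned = subst (All _) (map-element-coordinatesOf spans)
                (All.map⁺ (All.map (λ {c} → element-InSpan {c}) (basis-spans cs)))

theorem5p2 : Σ ℕ λ C →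
    (G : AbelianGroup 0ℓ 0ℓ) → GroupDefs.IsFinite G →
    (k : ℕ) → 1 ≤ k → (a : Fin k → AbelianGroup.Carrier G) →
    (R : ℕ) → 1 ≤ R →
    (b₀ : AbelianGroup.Carrier G) → (Bs : List (AbelianGroup.Carrier G)) →
    All (GroupDefs.InSpan G k a R) (b₀ ∷ Bs) →
    Σ ℕ λ ℓ → Σ ℕ λ S →
      (1 ≤ ℓ) × (ℓ ≤ C * (k * k * (lg k + lg R))) ×
      (1 ≤ S) × (S ≤ C * (2 * R * k) ^ (k + 3)) ×
      Σ (Fin ℓ → AbelianGroup.Carrier G) λ b →
        ((i : Fin ℓ) → GroupDefs._∈ₗ_ G (b i) (b₀ ∷ Bs)) ×
        All (GroupDefs.InSpan G ℓ b S) (b₀ ∷ Bs)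
theorem5p2 = 2 , λ G _ k 1≤k a R 1≤R b₀ Bs spans →
  let ℓ , b , 1≤ℓ , ℓ≤N , members , spanned = SpanningMembers.few-members-span G a R 1≤k 1≤R spans
  in ℓ , 1 , 1≤ℓ , ℕ.≤-trans ℓ≤N (basisBound≤ k R 1≤k) , s≤s z≤n , 1≤2[2Rk]^[k+3] k R 1≤k 1≤R , b , members , spanned
  where
  1≤2[2Rk]^[k+3] : ∀ k R → 1 ≤ k → 1 ≤ R → 1 ≤ 2 * (2 * R * k) ^ (k + 3)
  1≤2[2Rk]^[k+3] k R 1≤k 1≤R = ℕ.≤-trans (ℕ.m^n>0 (2 * R * k) {{2Rk≢0}} (k + 3)) (ℕ.m≤m+n _ _)
    where 2Rk≢0 = ℕ.>-nonZero (ℕ.*-mono-≤ (ℕ.*-mono-≤ {1} {2} (s≤s z≤n) 1≤R) 1≤k)
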